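{- Let $G$ be a finite graph and $\rho,\sigma\in\mathcal O(G)$. Then $\rho$ and $\sigma$ are cut-Eulerian equivalent if and only if (a) $E(B_\rho)=E(B_\sigma)$ and $E(C_\rho)=E(C_\sigma)$; (b) $E(B_\rho)\cap E(\rho\neq\sigma)$, oriented by $\rho$, is a locally directed cut of $(G,\rho)$; and (c) $E(C_\rho)\cap E(\rho\neq\sigma)$, oriented by $\rho$, is a directed Eulerian subgraph of $(G,\rho)$.
   Context: $G=(V,E)$ is a finite graph, loops and multiple edges allowed. An orientation chooses for each edge one of its two directions (loops also have two); $\mathcal O(G)$ is the set of orientations; $E(\rho\neq\sigma)$ is the set of edges on which $\rho,\sigma$ differ. A directed circuit of $(G,\rho)$ is a circuit oriented consistently around it; a bond is a minimal nonempty edge set $[S,V\setminus S]$ (edges joining $S$ and $V\setminus S$), directed if all its edges point from $S$ to $V\setminus S$ or all point the other way. $C_\rho$ is the union of the directed circuits of $(G,\rho)$ and $B_\rho$ the union of the directed bonds, with edge sets $E(C_\rho)$, $E(B_\rho)$. A locally directed cut is an edge set $[S,V\setminus S]$ with an orientation under which it is a disjoint union of directed bonds; a directed Eulerian subgraph is an edge set with an orientation under which every vertex has equal in- and out-degree; in this statement either may be empty. $\rho,\sigma$ are cut-Eulerian equivalent if $E(\rho\neq\sigma)$, oriented by $\rho$, is a disjoint union of a locally directed cut and a directed Eulerian subgraph. -}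

module Defs where

open import Data.Nat using (ℕ; zero; suc)
open import Data.Fin using (Fin; zero; suc; toℕ; fromℕ; _≟_)
open import Data.Bool using (Bool; true; false; if_then_else_)
open import Data.Product using (Σ; ∃; ∃-syntax; _×_; _,_; proj₁; proj₂)
open import Data.Sum using (_⊎_)
open import Data.Empty using (⊥)
open import Data.List using (List; []; _∷_; map; allFin; filter; length)
open import Data.List.Relation.Unary.All using (All)
open import Data.List.Relation.Unary.Any using (Any)
open import Data.List.Relation.Unary.AllPairs using (AllPairs)
open import Relation.Binary.PropositionalEquality using (_≡_; _≢_)
open import Relation.Nullary using (¬_; _×-dec_)
open import Function.Bundles using (_⇔_)
open import Function.Definitions using (Injective)
open import Data.Bool.Properties using () renaming (_≟_ to _≟ᵇ_)

-- Finite graphs, loops and multiple edges allowed.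
-- Vertices are Fin nV, edges Fin nE; each edge has an (unordered) pair
-- of ends; the pair order is only a reference to describe orientations.

record Graph : Set where
  field
    nV   : ℕ
    nE   : ℕ
    ends : Fin nE → Fin nV × Fin nV

module _ (G : Graph) where
  open Graph G

  Vertex : Set
  Vertex = Fin nV

  Edge : Set
  Edge = Fin nE

  -- An orientation picks one of the two directions of every edge
  -- (true: from the first end to the second; false: the reverse).
  -- Loops also have two (indistinguishable in terms of head/tail) directions.
  Orientation : Set
  Orientation = Edge → Bool

  tail : Orientation → Edge → Vertex
  tail ρ e = if ρ e then proj₁ (ends e) else proj₂ (ends e)

  head : Orientation → Edge → Vertex
  head ρ e = if ρ e then proj₂ (ends e) else proj₁ (ends e)

  EdgePred : Set₁
  EdgePred = Edge → Set

  _≐_ : EdgePred → EdgePred → Set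
  F ≐ F' = ∀ e → F e ⇔ F' e

  Differ : Orientation → Orientation → EdgePred
  Differ ρ σ e = ρ e ≢ σ e

  record DirCircuit (ρ : Orientation) : Set where
    field
      len      : ℕ                     -- number of edges is suc len
      edge     : Fin (suc len) → Edge
      edgeInj  : Injective _≡_ _≡_ edge
      vertInj  : Injective _≡_ _≡_ (λ i → tail ρ (edge i))
      step     : ∀ i j → toℕ j ≡ suc (toℕ i) → head ρ (edge i) ≡ tail ρ (edge j)
      close    : head ρ (edge (fromℕ len)) ≡ tail ρ (edge zero)

  EC : Orientation → EdgePred
  EC ρ e = Σ (DirCircuit ρ) λ C → ∃[ i ] DirCircuit.edge C i ≡ e

  VSet : Set
  VSet = Vertex → Bool

  Cut : VSet → EdgePred
  Cut S e = S (proj₁ (ends e)) ≢ S (proj₂ (ends e))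

  IsBond : VSet → Set
  IsBond S = (∃[ e ] Cut S e)
           × (∀ T → (∀ e → Cut T e → Cut S e) → (∃[ e ] Cut T e)
                  → ∀ e → Cut S e → Cut T e)

  IsDirectedCut : Orientation → VSet → Set
  IsDirectedCut ρ S = (∀ e → Cut S e → S (tail ρ e) ≡ true)
                    ⊎ (∀ e → Cut S e → S (tail ρ e) ≡ false)

  IsDirBond : Orientation → VSet → Set
  IsDirBond ρ S = IsBond S × IsDirectedCut ρ S

  EB : Orientation → EdgePred
  EB ρ e = ∃[ S ] (IsDirBond ρ S × Cut S e)

  IsLocDirCut : Orientation → EdgePred → Set
  IsLocDirCut ρ F =
    (Σ VSet λ S → (F ≐ Cut S))
    × (Σ (List VSet) λ Ss → ( All (IsDirBond ρ) Ss
               × AllPairs (λ S T → ∀ e → Cut S e → Cut T e → ⊥) Ss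
               × (F ≐ (λ e → Any (λ S → Cut S e) Ss))))

  count : (Edge → Bool) → (Edge → Vertex) → Vertex → ℕ
  count X f v = length (filter (λ e → (X e ≟ᵇ true) ×-dec (f e ≟ v)) (allFin nE))

  IsDirEulerian : Orientation → EdgePred → Set
  IsDirEulerian ρ F =
    Σ (Edge → Bool) λ X → ((F ≐ (λ e → X e ≡ true))
           × (∀ v → count X (tail ρ) v ≡ count X (head ρ) v))

  CutEulerianEquiv : Orientation → Orientation → Set
  CutEulerianEquiv ρ σ =
    Σ (Edge → Bool) λ D → Σ (Edge → Bool) λ U →
      ( (∀ e → D e ≡ true → U e ≡ true → ⊥)
      × (Differ ρ σ ≐ (λ e → (D e ≡ true) ⊎ (U e ≡ true)))
      × IsLocDirCut ρ (λ e → D e ≡ true)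
      × IsDirEulerian ρ (λ e → U e ≡ true))

-- Call an integer flow on the edges of (G, ρ) a circulation if its net flow out of every
-- vertex set is zero.  A nonnegative circulation vanishes on every directed cut, while the
-- traversal counts of a closed directed walk and the indicator of a directed Eulerian
-- subgraph are circulations.  Together with Minty's lemma (every edge lies on a directed
-- circuit or on a directed bond) this makes E(C_ρ) the set of edges on which some
-- nonnegative circulation is positive, and E(B_ρ) its complement.
--
-- If E(ρ≠σ) = D ⊎ U with D a locally directed cut and U directed Eulerian, then D ⊆ E(B_ρ)
-- and U ⊆ E(C_ρ), which gives (b) and (c).  For (a), let Y count the traversals of a
-- directed circuit through e and let M exceed every value of Y: since the only edges of Y
-- reversed by σ lie in U, the ρ-circulation Y − M·U, rewritten for σ, is a nonnegative
-- σ-circulation positive on e.  Thus E(C_ρ) ⊆ E(C_σ); the relation is symmetric, and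
-- E(B) follows by Minty's lemma.  Conversely, (b) and (c) provide D and U, and Minty's
-- lemma shows that they cover E(ρ≠σ).

module Submission where

open import Defs
open import Data.Bool using (Bool; true; false; not; _∧_; _∨_; _xor_; if_then_else_)
open import Data.Bool.Properties using (¬-not; not-injective; ⇔→≡) renaming (_≟_ to _≟ᵇ_)
open import Data.Empty using (⊥; ⊥-elim)
open import Data.Fin using (Fin; zero; suc; toℕ; fromℕ; inject₁) renaming (_≟_ to _≟ᶠ_)
open import Data.Fin.Properties using (toℕ-inject₁; any?)
open import Data.Fin.Subset using (∣_∣) renaming (_∈_ to _∈ₛ_)
open import Data.Fin.Subset.Properties using (∣p∣≤n; p⊂q⇒∣p∣<∣q∣)
open import Data.Integer using (ℤ; +_; 0ℤ; 1ℤ; _+_; _-_; -_; _*_; _≤_; _<_; +≤+; +<+)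
import Data.Integer.Properties as ℤ
open import Data.Integer.Tactic.RingSolver using (solve-∀)
open import Data.List using (List; []; _∷_; map; length; lookup; filter; tabulate)
open import Data.List.Membership.Propositional using (_∈_; _∉_)
open import Data.List.Membership.Propositional.Properties using (∈-map⁺; ∈-lookup)
import Data.List.Relation.Unary.All as All
open import Data.List.Relation.Unary.All.Properties using (¬Any⇒All¬)
open import Data.List.Relation.Unary.Any using (here; there)
import Data.List.Relation.Unary.Any as Any
open import Data.List.Relation.Unary.Unique.Propositional using (Unique; []; _∷_)
open import Data.Nat using (ℕ; zero; suc; z≤n; s≤s) renaming (_≤_ to _≤ₙ_; _<_ to _<ₙ_)
import Data.Nat.Properties as ℕ
open import Data.Product using (_×_; _,_; proj₁; proj₂; ∃-syntax)
open import Data.Sum using (_⊎_; inj₁; inj₂)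
import Data.Vec as Vec
open import Data.Vec.Properties using (lookup⇒[]=; []=⇒lookup; lookup∘tabulate)
open import Function.Bundles using (_⇔_; mk⇔; Equivalence)
import Function.Properties.Equivalence as ⇔
open import Relation.Binary.PropositionalEquality
  using (_≡_; _≢_; refl; sym; trans; cong; cong₂; subst; module ≡-Reasoning)
open import Relation.Nullary using (Dec; yes; no; does; ¬_; _×-dec_; _⊎-dec_)
open import Relation.Nullary.Decidable using (dec-true)
open import Algebra.Properties.Ring ℤ.+-*-ring using (x[y-z]≈xy-xz)
open import Algebra.Properties.Semiring.Sum ℤ.+-*-semiring using (*-distribˡ-sum; *-distribʳ-sum)
open import Algebra.Properties.CommutativeMonoid.Sum ℤ.+-0-commutativeMonoid
  using (sum; sum-cong-≗; sum-replicate-zero; ∑-distrib-+; ∑-comm; sum-init-last)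

false≢true : false ≢ true
false≢true ()

true≢false : true ≢ false
true≢false ()

xor≡true⇔≢ : ∀ a b → (a xor b ≡ true) ⇔ (a ≢ b)
xor≡true⇔≢ true  true  = mk⇔ (λ ()) (λ a≢b → ⊥-elim (a≢b refl))
xor≡true⇔≢ true  false = mk⇔ (λ _ ()) (λ _ → refl)
xor≡true⇔≢ false true  = mk⇔ (λ _ ()) (λ _ → refl)
xor≡true⇔≢ false false = mk⇔ (λ ()) (λ a≢b → ⊥-elim (a≢b refl))

𝟙 : Bool → ℤ
𝟙 true  = 1ℤ
𝟙 false = 0ℤ

∑-neg : ∀ {n} (f : Fin n → ℤ) → sum (λ i → - f i) ≡ - sum f
∑-neg {zero}  f = refl
∑-neg {suc n} f = trans (cong (_+_ (- f zero)) (∑-neg (λ i → f (suc i))))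
                        (sym (ℤ.neg-distrib-+ (f zero) _))

∑-distrib-minus : ∀ {n} (f g : Fin n → ℤ) → sum (λ i → f i - g i) ≡ sum f - sum g
∑-distrib-minus f g = trans (∑-distrib-+ f (λ i → - g i)) (cong (_+_ (sum f)) (∑-neg g))

∑-nonNeg : ∀ {n} (f : Fin n → ℤ) → (∀ i → 0ℤ ≤ f i) → 0ℤ ≤ sum f
∑-nonNeg {zero}  f f≥0 = ℤ.≤-refl
∑-nonNeg {suc n} f f≥0 = ℤ.+-mono-≤ (f≥0 zero) (∑-nonNeg (λ i → f (suc i)) (λ i → f≥0 (suc i)))

term≤∑ : ∀ {n} (f : Fin n → ℤ) → (∀ i → 0ℤ ≤ f i) → ∀ i → f i ≤ sum f
term≤∑ {suc n} f f≥0 zero = begin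
  f zero       ≡⟨ ℤ.+-identityʳ (f zero) ⟨
  f zero + 0ℤ  ≤⟨ ℤ.+-monoʳ-≤ (f zero) (∑-nonNeg (λ i → f (suc i)) (λ i → f≥0 (suc i))) ⟩
  sum f        ∎
  where open ℤ.≤-Reasoning
term≤∑ {suc n} f f≥0 (suc i) = begin
  f (suc i)                   ≤⟨ term≤∑ (λ i → f (suc i)) (λ i → f≥0 (suc i)) i ⟩
  sum (λ i → f (suc i))       ≡⟨ ℤ.+-identityˡ _ ⟨
  0ℤ + sum (λ i → f (suc i))  ≤⟨ ℤ.+-monoˡ-≤ (sum (λ i → f (suc i))) (f≥0 zero) ⟩
  sum f                       ∎
  where open ℤ.≤-Reasoning

∑-pick : ∀ {n} (i : Fin n) (g : Fin n → ℤ) → sum (λ j → 𝟙 (does (i ≟ᶠ j)) * g j) ≡ g i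
∑-pick {suc n} zero    g =
  trans (cong₂ _+_ (ℤ.*-identityˡ (g zero)) (sum-replicate-zero n)) (ℤ.+-identityʳ (g zero))
∑-pick {suc n} (suc i) g = trans (ℤ.+-identityˡ _) (∑-pick i (λ j → g (suc j)))

𝟙-∧ : ∀ a b → 𝟙 (a ∧ b) ≡ 𝟙 a * 𝟙 b
𝟙-∧ true  true  = refl
𝟙-∧ true  false = refl
𝟙-∧ false b     = refl

0≤𝟙 : ∀ b → 0ℤ ≤ 𝟙 b
0≤𝟙 true  = +≤+ z≤n
0≤𝟙 false = ℤ.≤-refl

0≤*𝟙 : ∀ {x} b → 0ℤ ≤ x → 0ℤ ≤ x * 𝟙 b
0≤*𝟙 {x} true  0≤x = subst (0ℤ ≤_) (sym (ℤ.*-identityʳ x)) 0≤x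
0≤*𝟙 {x} false _   = subst (0ℤ ≤_) (sym (ℤ.*-zeroʳ x)) ℤ.≤-refl

length-filter-tabulate : ∀ {a n} {A : Set a} {P : A → Set} (P? : ∀ x → Dec (P x)) (g : Fin n → A) →
                         + length (filter P? (tabulate g)) ≡ sum (λ i → 𝟙 (does (P? (g i))))
length-filter-tabulate {n = zero}  P? g = refl
length-filter-tabulate {n = suc n} P? g with does (P? (g zero))
... | true  = cong (_+_ 1ℤ) (length-filter-tabulate P? (λ i → g (suc i)))
... | false = trans (length-filter-tabulate P? (λ i → g (suc i))) (sym (ℤ.+-identityˡ _))

∑-rotate : ∀ {k} (a b : Fin (suc k) → ℤ) →
           (∀ i j → toℕ j ≡ suc (toℕ i) → b i ≡ a j) → b (fromℕ k) ≡ a zero →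
           sum b ≡ sum a
∑-rotate {k} a b shift wrap = begin
  sum b                                   ≡⟨ sum-init-last b ⟩
  sum (λ i → b (inject₁ i)) + b (fromℕ k) ≡⟨ cong₂ _+_ (sum-cong-≗ shifted) wrap ⟩
  sum (λ i → a (suc i)) + a zero          ≡⟨ ℤ.+-comm _ (a zero) ⟩
  sum a                                   ∎
  where
  open ≡-Reasoning
  shifted : ∀ i → b (inject₁ i) ≡ a (suc i)
  shifted i = shift (inject₁ i) (suc i) (cong suc (sym (toℕ-inject₁ i)))

-- Reachability

size : ∀ {n} → (Fin n → Bool) → ℕ
size X = ∣ Vec.tabulate X ∣

∈-tabulate⁺ : ∀ {n} (X : Fin n → Bool) {u} → X u ≡ true → u ∈ₛ Vec.tabulate X
∈-tabulate⁺ X {u} Xu = lookup⇒[]= u (Vec.tabulate X) (trans (lookup∘tabulate X u) Xu)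

∈-tabulate⁻ : ∀ {n} (X : Fin n → Bool) {u} → u ∈ₛ Vec.tabulate X → X u ≡ true
∈-tabulate⁻ X {u} u∈X = trans (sym (lookup∘tabulate X u)) ([]=⇒lookup u∈X)

size-grows : ∀ {n} {X Y : Fin n → Bool} → (∀ v → X v ≡ true → Y v ≡ true) →
             ∀ v → X v ≡ false → Y v ≡ true → size X <ₙ size Y
size-grows {X = X} {Y} X⊆Y v Xv Yv = p⊂q⇒∣p∣<∣q∣
  ( (λ {u} u∈X → ∈-tabulate⁺ Y (X⊆Y u (∈-tabulate⁻ X u∈X)))
  , v , ∈-tabulate⁺ Y Yv , λ v∈X → false≢true (trans (sym Xv) (∈-tabulate⁻ X v∈X)))

module Reach {n : ℕ} {_⟶_ : Fin n → Fin n → Set} (_⟶?_ : ∀ u v → Dec (u ⟶ v)) (s : Fin n) where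

  IsClosed : (Fin n → Bool) → Set
  IsClosed X = ∀ {u v} → X u ≡ true → u ⟶ v → X v ≡ true

  expand : (Fin n → Bool) → Fin n → Bool
  expand X v = X v ∨ does (any? λ u → (X u ≟ᵇ true) ×-dec (u ⟶? v))

  expand-⊇ : ∀ X v → X v ≡ true → expand X v ≡ true
  expand-⊇ X v Xv rewrite Xv = refl

  expand-step : ∀ X {u v} → X u ≡ true → u ⟶ v → expand X v ≡ true
  expand-step X {u} {v} Xu u⟶v with X v
  ... | true  = refl
  ... | false = dec-true (any? λ u → (X u ≟ᵇ true) ×-dec (u ⟶? v)) (u , Xu , u⟶v)

  expand-ind : ∀ X (P : Fin n → Set) → (∀ v → X v ≡ true → P v) →
               (∀ {u v} → P u → u ⟶ v → P v) → ∀ v → expand X v ≡ true → P v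
  expand-ind X P base step v Ev with X v in Xv | any? (λ u → (X u ≟ᵇ true) ×-dec (u ⟶? v))
  ... | true  | _                   = base v Xv
  ... | false | yes (u , Xu , u⟶v) = step (base u Xu) u⟶v

  closed⇒expand⊆ : ∀ {X} → IsClosed X → ∀ v → expand X v ≡ true → X v ≡ true
  closed⇒expand⊆ {X} closed = expand-ind X (λ v → X v ≡ true) (λ _ Xv → Xv) closed

  expand-closed : ∀ {X} → IsClosed X → IsClosed (expand X)
  expand-closed {X} closed {u} EXu u⟶v = expand-⊇ X _ (closed (closed⇒expand⊆ closed u EXu) u⟶v)

  closed-or-grows : ∀ X → IsClosed X ⊎ ∃[ v ] (X v ≡ false × expand X v ≡ true)
  closed-or-grows X with any? (λ v → (X v ≟ᵇ false) ×-dec (expand X v ≟ᵇ true))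
  ... | yes grows  = inj₂ grows
  ... | no ¬grows = inj₁ λ {u} {v} Xu u⟶v → ¬-not (λ Xv → ¬grows (v , Xv , expand-step X Xu u⟶v))

  iterate : ℕ → Fin n → Bool
  iterate zero    = λ v → does (s ≟ᶠ v)
  iterate (suc k) = expand (iterate k)

  -- Each round either is closed or adds a vertex, so n + 1 rounds reach a closed set.
  closed-or-large : ∀ k → IsClosed (iterate k) ⊎ k ≤ₙ size (iterate k)
  closed-or-large zero = inj₂ z≤n
  closed-or-large (suc k) with closed-or-grows (iterate k) | closed-or-large k
  ... | inj₁ closed         | _           = inj₁ (expand-closed closed)
  ... | inj₂ (v , Xv , EXv) | inj₁ closed =
    ⊥-elim (false≢true (trans (sym Xv) (closed⇒expand⊆ closed v EXv)))
  ... | inj₂ (v , Xv , EXv) | inj₂ k≤size =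
    inj₂ (ℕ.≤-trans (s≤s k≤size) (size-grows (expand-⊇ (iterate k)) v Xv EXv))

  -- Opaque, since unfolding the iterated closure makes type checking explode.
  opaque
    reachable : Fin n → Bool
    reachable = iterate (suc n)

    reachable-closed : IsClosed reachable
    reachable-closed with closed-or-large (suc n)
    ... | inj₁ closed = closed
    ... | inj₂ large  = ⊥-elim (ℕ.<-irrefl refl (ℕ.≤-trans large (∣p∣≤n (Vec.tabulate reachable))))

    source-reachable : reachable s ≡ true
    source-reachable = go (suc n)
      where
      go : ∀ k → iterate k s ≡ true
      go zero    = dec-true (s ≟ᶠ s) refl
      go (suc k) = expand-⊇ (iterate k) s (go k)

    reachable-ind : (P : Fin n → Set) → P s → (∀ {u v} → P u → u ⟶ v → P v) →
                    ∀ v → reachable v ≡ true → P v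
    reachable-ind P Ps step = go (suc n)
      where
      go : ∀ k v → iterate k v ≡ true → P v
      go zero    v s≟v with s ≟ᶠ v
      ... | yes refl = Ps
      go (suc k) = expand-ind (iterate k) P (go k) step

map-lookup-injective : ∀ {a b} {A : Set a} {B : Set b} (f : A → B) {xs : List A} →
                       Unique (map f xs) → ∀ {i j} → f (lookup xs i) ≡ f (lookup xs j) → i ≡ j
map-lookup-injective f {x ∷ xs} _ {zero} {zero} _ = refl
map-lookup-injective f {x ∷ xs} (fx∉ ∷ _) {zero} {suc j} eq =
  ⊥-elim (All.lookup fx∉ (∈-map⁺ f (∈-lookup j)) eq)
map-lookup-injective f {x ∷ xs} (fx∉ ∷ _) {suc i} {zero} eq =
  ⊥-elim (All.lookup fx∉ (∈-map⁺ f (∈-lookup i)) (sym eq))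
map-lookup-injective f {x ∷ xs} (_ ∷ unique) {suc i} {suc j} eq =
  cong suc (map-lookup-injective f unique eq)

-- Circulations

module _ (G : Graph) where
  open Graph G

  cut⇒tail≢head : ∀ ρ (S : VSet G) e → Cut G S e → S (tail G ρ e) ≢ S (head G ρ e)
  cut⇒tail≢head ρ S e c with ρ e
  ... | true  = c
  ... | false = λ eq → c (sym eq)

  tail≢head⇒cut : ∀ ρ (S : VSet G) e → S (tail G ρ e) ≢ S (head G ρ e) → Cut G S e
  tail≢head⇒cut ρ S e c with ρ e
  ... | true  = c
  ... | false = λ eq → c (sym eq)

  cut⇒head≡not-tail : ∀ ρ (S : VSet G) e → Cut G S e → S (head G ρ e) ≡ not (S (tail G ρ e))
  cut⇒head≡not-tail ρ S e cut = ¬-not λ eq → cut⇒tail≢head ρ S e cut (sym eq)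

  ¬cut⇒tail≡head : ∀ ρ (S : VSet G) e → ¬ Cut G S e → S (tail G ρ e) ≡ S (head G ρ e)
  ¬cut⇒tail≡head ρ S e ¬cut with S (tail G ρ e) ≟ᵇ S (head G ρ e)
  ... | yes same = same
  ... | no  diff = ⊥-elim (¬cut (tail≢head⇒cut ρ S e diff))

  crossing : Orientation G → VSet G → Edge G → ℤ
  crossing ρ S e = 𝟙 (S (tail G ρ e)) - 𝟙 (S (head G ρ e))

  netFlow : Orientation G → VSet G → (Edge G → ℤ) → ℤ
  netFlow ρ S f = sum (λ e → f e * crossing ρ S e)

  IsCirculation : Orientation G → (Edge G → ℤ) → Set
  IsCirculation ρ f = ∀ S → netFlow ρ S f ≡ 0ℤ

  IsOutward : Orientation G → VSet G → Set
  IsOutward ρ S = ∀ e → Cut G S e → S (tail G ρ e) ≡ true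

  crossing-outward : ∀ ρ S → IsOutward ρ S → ∀ e →
                     crossing ρ S e ≡ 𝟙 (S (tail G ρ e) ∧ not (S (head G ρ e)))
  crossing-outward ρ S out e with S (tail G ρ e) in t | S (head G ρ e) in h
  ... | true  | true  = refl
  ... | true  | false = refl
  ... | false | false = refl
  ... | false | true  = ⊥-elim (false≢true (trans (sym t) (out e cut)))
    where
    cut : Cut G S e
    cut = tail≢head⇒cut ρ S e λ eq → false≢true (trans (sym t) (trans eq h))

  circulation-avoids-outwardCut : ∀ {ρ f e} → IsCirculation ρ f → (∀ e → 0ℤ ≤ f e) →
                                  0ℤ < f e → ∀ S → IsOutward ρ S → ¬ Cut G S e
  circulation-avoids-outwardCut {ρ} {f} {e} circ f≥0 0<fe S out cut =
    ℤ.<-irrefl refl (begin-strict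
      0ℤ                    <⟨ 0<fe ⟩
      f e                   ≡⟨ ℤ.*-identityʳ (f e) ⟨
      f e * 1ℤ              ≡⟨ cong (f e *_) crossing-e ⟨
      f e * crossing ρ S e  ≤⟨ term≤∑ _ terms≥0 e ⟩
      netFlow ρ S f         ≡⟨ circ S ⟩
      0ℤ                    ∎)
    where
    open ℤ.≤-Reasoning
    terms≥0 : ∀ e' → 0ℤ ≤ f e' * crossing ρ S e'
    terms≥0 e' = subst (λ c → 0ℤ ≤ f e' * c) (sym (crossing-outward ρ S out e')) (0≤*𝟙 _ (f≥0 e'))
    head-outside : S (head G ρ e) ≡ false
    head-outside = trans (cut⇒head≡not-tail ρ S e cut) (cong not (out e cut))
    crossing-e : crossing ρ S e ≡ 1ℤ
    crossing-e = trans (crossing-outward ρ S out e) (cong₂ (λ a b → 𝟙 (a ∧ not b)) (out e cut) head-outside)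

  circulation-avoids-directedCut : ∀ {ρ f e} → IsCirculation ρ f → (∀ e → 0ℤ ≤ f e) →
                                   0ℤ < f e → ∀ S → IsDirectedCut G ρ S → ¬ Cut G S e
  circulation-avoids-directedCut circ f≥0 0<fe S (inj₁ out) = circulation-avoids-outwardCut circ f≥0 0<fe S out
  -- An inward cut of S is an outward cut of its complement.
  circulation-avoids-directedCut circ f≥0 0<fe S (inj₂ inward) cut =
    circulation-avoids-outwardCut circ f≥0 0<fe (λ v → not (S v))
      (λ e c → cong not (inward e λ eq → c (cong not eq)))
      (λ eq → cut (not-injective eq))

  count-as-sum : ∀ X f v → + count G X f v ≡ sum (λ e → 𝟙 (X e) * 𝟙 (does (f e ≟ᶠ v)))
  count-as-sum X f v =
    trans (length-filter-tabulate (λ e → (X e ≟ᵇ true) ×-dec (f e ≟ᶠ v)) (λ e → e))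
          (sum-cong-≗ λ e → trans (cong (λ b → 𝟙 (b ∧ _)) (does-≟true (X e))) (𝟙-∧ (X e) _))
    where
    does-≟true : ∀ b → does (b ≟ᵇ true) ≡ b
    does-≟true true  = refl
    does-≟true false = refl

  ∑-fibres : ∀ X (f : Edge G → Vertex G) (g : Vertex G → ℤ) →
             sum (λ e → 𝟙 (X e) * g (f e)) ≡ sum (λ v → + count G X f v * g v)
  ∑-fibres X f g = begin
    sum (λ e → 𝟙 (X e) * g (f e))
      ≡⟨ sum-cong-≗ (λ e → cong (𝟙 (X e) *_) (∑-pick (f e) g)) ⟨
    sum (λ e → 𝟙 (X e) * sum (λ v → 𝟙 (δ e v) * g v))
      ≡⟨ sum-cong-≗ (λ e → trans (*-distribˡ-sum (𝟙 (X e)) (λ v → 𝟙 (δ e v) * g v))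
                                  (sum-cong-≗ λ v → sym (ℤ.*-assoc (𝟙 (X e)) (𝟙 (δ e v)) (g v)))) ⟩
    sum (λ e → sum (λ v → 𝟙 (X e) * 𝟙 (δ e v) * g v))
      ≡⟨ ∑-comm (λ e v → 𝟙 (X e) * 𝟙 (δ e v) * g v) ⟩
    sum (λ v → sum (λ e → 𝟙 (X e) * 𝟙 (δ e v) * g v))
      ≡⟨ sum-cong-≗ (λ v → sym (*-distribʳ-sum (g v) (λ e → 𝟙 (X e) * 𝟙 (δ e v)))) ⟩
    sum (λ v → sum (λ e → 𝟙 (X e) * 𝟙 (δ e v)) * g v)
      ≡⟨ sum-cong-≗ (λ v → cong (_* g v) (count-as-sum X f v)) ⟨
    sum (λ v → + count G X f v * g v)  ∎
    where
    open ≡-Reasoning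
    δ : Edge G → Vertex G → Bool
    δ e v = does (f e ≟ᶠ v)

  eulerian⇒circulation : ∀ ρ X → (∀ v → count G X (tail G ρ) v ≡ count G X (head G ρ) v) →
                         IsCirculation ρ (λ e → 𝟙 (X e))
  eulerian⇒circulation ρ X balanced S = begin
    sum (λ e → 𝟙 (X e) * (χ (tail G ρ e) - χ (head G ρ e)))
      ≡⟨ sum-cong-≗ (λ e → x[y-z]≈xy-xz (𝟙 (X e)) _ _) ⟩
    sum (λ e → leaving e - entering e)
      ≡⟨ ∑-distrib-minus leaving entering ⟩
    sum leaving - sum entering
      ≡⟨ cong₂ _-_ (∑-fibres X (tail G ρ) χ) (∑-fibres X (head G ρ) χ) ⟩
    sum (λ v → + count G X (tail G ρ) v * χ v) - sum (λ v → + count G X (head G ρ) v * χ v)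
      ≡⟨ cong (λ h → h - sum (λ v → + count G X (head G ρ) v * χ v))
              (sum-cong-≗ λ v → cong (λ c → + c * χ v) (balanced v)) ⟩
    sum (λ v → + count G X (head G ρ) v * χ v) - sum (λ v → + count G X (head G ρ) v * χ v)
      ≡⟨ ℤ.+-inverseʳ (sum (λ v → + count G X (head G ρ) v * χ v)) ⟩
    0ℤ  ∎
    where
    open ≡-Reasoning
    χ : Vertex G → ℤ
    χ v = 𝟙 (S v)
    leaving entering : Edge G → ℤ
    leaving e  = 𝟙 (X e) * χ (tail G ρ e)
    entering e = 𝟙 (X e) * χ (head G ρ e)

  traversals : ∀ {k} → (Fin k → Edge G) → Edge G → ℤ
  traversals w e = sum (λ i → 𝟙 (does (w i ≟ᶠ e)))

  traversals≥0 : ∀ {k} (w : Fin k → Edge G) e → 0ℤ ≤ traversals w e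
  traversals≥0 w e = ∑-nonNeg (λ i → 𝟙 (does (w i ≟ᶠ e))) (λ i → 0≤𝟙 _)

  traversals>0 : ∀ {k} (w : Fin k → Edge G) i → 0ℤ < traversals w (w i)
  traversals>0 w i = ℤ.<-≤-trans
    (subst (0ℤ <_) (cong 𝟙 (sym (dec-true (w i ≟ᶠ w i) refl))) (+<+ (s≤s z≤n)))
    (term≤∑ (λ j → 𝟙 (does (w j ≟ᶠ w i))) (λ j → 0≤𝟙 _) i)

  closedWalk⇒circulation : ∀ ρ {k} (w : Fin (suc k) → Edge G) →
    (∀ i j → toℕ j ≡ suc (toℕ i) → head G ρ (w i) ≡ tail G ρ (w j)) →
    head G ρ (w (fromℕ k)) ≡ tail G ρ (w zero) →
    IsCirculation ρ (traversals w)
  closedWalk⇒circulation ρ w step close S = begin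
    sum (λ e → traversals w e * crossing ρ S e)
      ≡⟨ sum-cong-≗ (λ e → *-distribʳ-sum (crossing ρ S e) (λ i → 𝟙 (does (w i ≟ᶠ e)))) ⟩
    sum (λ e → sum (λ i → 𝟙 (does (w i ≟ᶠ e)) * crossing ρ S e))
      ≡⟨ ∑-comm (λ e i → 𝟙 (does (w i ≟ᶠ e)) * crossing ρ S e) ⟩
    sum (λ i → sum (λ e → 𝟙 (does (w i ≟ᶠ e)) * crossing ρ S e))
      ≡⟨ sum-cong-≗ (λ i → ∑-pick (w i) (crossing ρ S)) ⟩
    sum (λ i → χ (tail G ρ (w i)) - χ (head G ρ (w i)))
      ≡⟨ ∑-distrib-minus (λ i → χ (tail G ρ (w i))) (λ i → χ (head G ρ (w i))) ⟩
    sum (λ i → χ (tail G ρ (w i))) - sum (λ i → χ (head G ρ (w i)))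
      ≡⟨ cong (_-_ (sum (λ i → χ (tail G ρ (w i)))))
              (∑-rotate (λ i → χ (tail G ρ (w i))) (λ i → χ (head G ρ (w i)))
                        (λ i j p → cong χ (step i j p)) (cong χ close)) ⟩
    sum (λ i → χ (tail G ρ (w i))) - sum (λ i → χ (tail G ρ (w i)))
      ≡⟨ ℤ.+-inverseʳ (sum (λ i → χ (tail G ρ (w i)))) ⟩
    0ℤ  ∎
    where
    open ≡-Reasoning
    χ : Vertex G → ℤ
    χ v = 𝟙 (S v)

  circulation-combine : ∀ ρ {f g} → IsCirculation ρ f → IsCirculation ρ g → ∀ c →
                        IsCirculation ρ (λ e → f e - c * g e)
  circulation-combine ρ {f} {g} circ-f circ-g c S = begin
    sum (λ e → (f e - c * g e) * x e)
      ≡⟨ sum-cong-≗ (λ e → distrib (f e) c (g e) (x e)) ⟩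
    sum (λ e → f e * x e - c * (g e * x e))
      ≡⟨ ∑-distrib-minus (λ e → f e * x e) (λ e → c * (g e * x e)) ⟩
    netFlow ρ S f - sum (λ e → c * (g e * x e))
      ≡⟨ cong (_-_ (netFlow ρ S f)) (*-distribˡ-sum c (λ e → g e * x e)) ⟨
    netFlow ρ S f - c * netFlow ρ S g
      ≡⟨ cong₂ (λ a b → a - c * b) (circ-f S) (circ-g S) ⟩
    0ℤ - c * 0ℤ
      ≡⟨ cong (λ a → 0ℤ - a) (ℤ.*-zeroʳ c) ⟩
    0ℤ  ∎
    where
    open ≡-Reasoning
    x : Edge G → ℤ
    x = crossing ρ S
    distrib : ∀ a k b y → (a - k * b) * y ≡ a * y - k * (b * y)
    distrib = solve-∀

  reorient : Orientation G → Orientation G → (Edge G → ℤ) → Edge G → ℤ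
  reorient ρ σ f e = if does (ρ e ≟ᵇ σ e) then f e else - f e

  reorient-circulation : ∀ ρ σ {f} → IsCirculation ρ f → IsCirculation σ (reorient ρ σ f)
  reorient-circulation ρ σ {f} circ S = trans (sum-cong-≗ same-flow) (circ S)
    where
    neg-swap : ∀ x a b → (- x) * (b - a) ≡ x * (a - b)
    neg-swap = solve-∀
    same-flow : ∀ e → reorient ρ σ f e * crossing σ S e ≡ f e * crossing ρ S e
    same-flow e with ρ e | σ e
    ... | true  | true  = refl
    ... | false | false = refl
    ... | true  | false = neg-swap (f e) (𝟙 (S (proj₁ (ends e)))) (𝟙 (S (proj₂ (ends e))))
    ... | false | true  = neg-swap (f e) (𝟙 (S (proj₂ (ends e)))) (𝟙 (S (proj₁ (ends e))))


-- Reversing edges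

module _ (G : Graph) where
  open Graph G

  IsLocDirCut-resp-≐ : ∀ {ρ F F'} → _≐_ G F F' → IsLocDirCut G ρ F → IsLocDirCut G ρ F'
  IsLocDirCut-resp-≐ F≐F' ((S , F≐S) , Ss , dirBonds , disjoint , F≐bonds) =
    (S , λ e → ⇔.trans (⇔.sym (F≐F' e)) (F≐S e)) , Ss , dirBonds , disjoint ,
    λ e → ⇔.trans (⇔.sym (F≐F' e)) (F≐bonds e)

  IsDirEulerian-resp-≐ : ∀ {ρ F F'} → _≐_ G F F' → IsDirEulerian G ρ F → IsDirEulerian G ρ F'
  IsDirEulerian-resp-≐ F≐F' (X , F≐X , balanced) =
    X , (λ e → ⇔.trans (⇔.sym (F≐F' e)) (F≐X e)) , balanced

  tail-reversed : ∀ ρ σ e → Differ G ρ σ e → tail G σ e ≡ head G ρ e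
  tail-reversed ρ σ e diff with ρ e | σ e
  ... | true  | true  = ⊥-elim (diff refl)
  ... | true  | false = refl
  ... | false | true  = refl
  ... | false | false = ⊥-elim (diff refl)

  head-reversed : ∀ ρ σ e → Differ G ρ σ e → head G σ e ≡ tail G ρ e
  head-reversed ρ σ e diff with ρ e | σ e
  ... | true  | true  = ⊥-elim (diff refl)
  ... | true  | false = refl
  ... | false | true  = refl
  ... | false | false = ⊥-elim (diff refl)

  reverse-directedCut : ∀ ρ σ S → (∀ e → Cut G S e → Differ G ρ σ e) →
                        IsDirectedCut G ρ S → IsDirectedCut G σ S
  reverse-directedCut ρ σ S S⊆Δ (inj₁ out) = inj₂ λ e c →
    trans (cong S (tail-reversed ρ σ e (S⊆Δ e c))) (trans (cut⇒head≡not-tail G ρ S e c) (cong not (out e c)))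
  reverse-directedCut ρ σ S S⊆Δ (inj₂ inw) = inj₁ λ e c →
    trans (cong S (tail-reversed ρ σ e (S⊆Δ e c))) (trans (cut⇒head≡not-tail G ρ S e c) (cong not (inw e c)))

  reverse-locDirCut : ∀ ρ σ {F} → (∀ e → F e → Differ G ρ σ e) →
                      IsLocDirCut G ρ F → IsLocDirCut G σ F
  reverse-locDirCut ρ σ F⊆Δ (cut , Ss , dirBonds , disjoint , F≐bonds) =
    cut , Ss , All.tabulate reversed , disjoint , F≐bonds
    where
    reversed : ∀ {S} → S ∈ Ss → IsDirBond G σ S
    reversed {S} S∈Ss with All.lookup dirBonds S∈Ss
    ... | bond , directed = bond , reverse-directedCut ρ σ S (λ e c →
          F⊆Δ e (Equivalence.from (F≐bonds e) (Any.map (λ { refl → c }) S∈Ss))) directed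

  count-cong : ∀ X {f g : Edge G → Vertex G} → (∀ e → X e ≡ true → f e ≡ g e) →
               ∀ v → count G X f v ≡ count G X g v
  count-cong X {f} {g} f≗g v = ℤ.+-injective (trans (count-as-sum G X f v)
    (trans (sum-cong-≗ same) (sym (count-as-sum G X g v))))
    where
    same : ∀ e → 𝟙 (X e) * 𝟙 (does (f e ≟ᶠ v)) ≡ 𝟙 (X e) * 𝟙 (does (g e ≟ᶠ v))
    same e with X e in Xe
    ... | true  = cong (λ w → 1ℤ * 𝟙 (does (w ≟ᶠ v))) (f≗g e Xe)
    ... | false = refl

  reverse-dirEulerian : ∀ ρ σ {F} → (∀ e → F e → Differ G ρ σ e) →
                        IsDirEulerian G ρ F → IsDirEulerian G σ F
  reverse-dirEulerian ρ σ F⊆Δ (X , F≐X , balanced) = X , F≐X , λ v → begin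
    count G X (tail G σ) v  ≡⟨ count-cong X (λ e Xe → tail-reversed ρ σ e (X⊆Δ e Xe)) v ⟩
    count G X (head G ρ) v  ≡⟨ balanced v ⟨
    count G X (tail G ρ) v  ≡⟨ count-cong X (λ e Xe → head-reversed ρ σ e (X⊆Δ e Xe)) v ⟨
    count G X (head G σ) v  ∎
    where
    open ≡-Reasoning
    X⊆Δ : ∀ e → X e ≡ true → Differ G ρ σ e
    X⊆Δ e Xe = F⊆Δ e (Equivalence.from (F≐X e) Xe)

  CutEulerianEquiv-sym : ∀ {ρ σ} → CutEulerianEquiv G ρ σ → CutEulerianEquiv G σ ρ
  CutEulerianEquiv-sym {ρ} {σ} (D , U , disjoint , Δ≐D∪U , D-cut , U-eulerian) =
    D , U , disjoint , (λ e → ⇔.trans (mk⇔ (λ d eq → d (sym eq)) (λ d eq → d (sym eq))) (Δ≐D∪U e)) ,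
    reverse-locDirCut ρ σ (λ e De → from (Δ≐D∪U e) (inj₁ De)) D-cut ,
    reverse-dirEulerian ρ σ (λ e Ue → from (Δ≐D∪U e) (inj₂ Ue)) U-eulerian
    where open Equivalence

-- Directed walks and circuits

module _ (G : Graph) (ρ : Orientation G) where
  open Graph G
  open import Data.List.Membership.DecPropositional (_≟ᶠ_ {nV}) using (_∈?_)

  Walk : Vertex G → List (Edge G) → Vertex G → Set
  Walk a []       b = a ≡ b
  Walk a (e ∷ es) b = tail G ρ e ≡ a × Walk (head G ρ e) es b

  walk-step : ∀ {a b} c cs → Walk a (c ∷ cs) b → ∀ i j → toℕ j ≡ suc (toℕ i) →
              head G ρ (lookup (c ∷ cs) i) ≡ tail G ρ (lookup (c ∷ cs) j)
  walk-step c (c' ∷ cs) (_ , c'-from , _) zero    (suc zero) _   = sym c'-from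
  walk-step c (c' ∷ cs) (_ , w)           (suc i) (suc j)    j≡i =
    walk-step c' cs w i j (ℕ.suc-injective j≡i)

  walk-end : ∀ {a b} c cs → Walk a (c ∷ cs) b → head G ρ (lookup (c ∷ cs) (fromℕ (length cs))) ≡ b
  walk-end c []        (_ , end) = end
  walk-end c (c' ∷ cs) (_ , w)   = walk-end c' cs w

  closedWalk⇒circuit : ∀ {a} c cs → Walk a (c ∷ cs) a → Unique (map (tail G ρ) (c ∷ cs)) →
                       DirCircuit G ρ
  closedWalk⇒circuit c cs w unique = record
    { len     = length cs
    ; edge    = lookup (c ∷ cs)
    ; edgeInj = λ eq → map-lookup-injective (tail G ρ) unique (cong (tail G ρ) eq)
    ; vertInj = map-lookup-injective (tail G ρ) unique
    ; step    = walk-step c cs w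
    ; close   = trans (walk-end c cs w) (sym (proj₁ w))
    }

  record SimplePath (a b : Vertex G) : Set where
    field
      edges     : List (Edge G)
      walk      : Walk a edges b
      unique    : Unique (map (tail G ρ) edges)
      end-fresh : b ∉ map (tail G ρ) edges

  suffix : ∀ {a b} es → Walk a es b → Unique (map (tail G ρ) es) → b ∉ map (tail G ρ) es →
           ∀ {c} → c ∈ map (tail G ρ) es → SimplePath c b
  suffix (e ∷ es) (_ , w) unique       fresh (here c≡) = record
    { edges = e ∷ es ; walk = sym c≡ , w ; unique = unique ; end-fresh = fresh }
  suffix (e ∷ es) (_ , w) (_ ∷ unique) fresh (there m) = suffix es w unique (λ b∈ → fresh (there b∈)) m

  -- If the new start vertex already lies on the path, the path is cut there instead.
  prepend : ∀ {u b} e → head G ρ e ≡ u → SimplePath u b → SimplePath (tail G ρ e) b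
  prepend {b = b} e e-to record { edges = es ; walk = w ; unique = u ; end-fresh = b∉ }
    with tail G ρ e ≟ᶠ b | tail G ρ e ∈? map (tail G ρ) es
  ... | yes e-from-b | _        = record { edges = [] ; walk = e-from-b ; unique = [] ; end-fresh = λ () }
  ... | no _         | yes e∈es = suffix es w u b∉ e∈es
  ... | no e-from≢b  | no e∉es  = record
    { edges     = e ∷ es
    ; walk      = refl , subst (λ v → Walk v es b) (sym e-to) w
    ; unique    = ¬Any⇒All¬ _ e∉es ∷ u
    ; end-fresh = λ { (here b≡) → e-from≢b (sym b≡) ; (there b∈) → b∉ b∈ }
    }

  closingPath⇒EC : ∀ e → SimplePath (head G ρ e) (tail G ρ e) → EC G ρ e
  closingPath⇒EC e record { edges = es ; walk = w ; unique = u ; end-fresh = t∉ } =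
    closedWalk⇒circuit e es (refl , w) (¬Any⇒All¬ _ t∉ ∷ u) , zero , refl

-- Minty's lemma

module Minty (G : Graph) (ρ : Orientation G) where
  open Graph G

  private
    tl hd : Edge G → Vertex G
    tl = tail G ρ
    hd = head G ρ

  Backstep : Vertex G → Vertex G → Set
  Backstep u v = ∃[ e ] (hd e ≡ u × tl e ≡ v)

  backstep? : ∀ u v → Dec (Backstep u v)
  backstep? u v = any? λ e → (hd e ≟ᶠ u) ×-dec (tl e ≟ᶠ v)

  -- ReachesTo.reachable t v holds when t can be reached from v by a directed path.
  module ReachesTo (t : Vertex G) = Reach backstep? t

  Joins : Edge G → Vertex G → Vertex G → Set
  Joins e u v = (tl e ≡ u × hd e ≡ v) ⊎ (hd e ≡ u × tl e ≡ v)

  Link : VSet G → Vertex G → Vertex G → Set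
  Link X u v = ∃[ e ] (X (tl e) ≡ false × X (hd e) ≡ false × Joins e u v)

  link? : ∀ X u v → Dec (Link X u v)
  link? X u v = any? λ e →
    (X (tl e) ≟ᵇ false) ×-dec (X (hd e) ≟ᵇ false)
      ×-dec (((tl e ≟ᶠ u) ×-dec (hd e ≟ᶠ v)) ⊎-dec ((hd e ≟ᶠ u) ×-dec (tl e ≟ᶠ v)))

  -- ComponentAvoiding.reachable X s is the component of s in G − X.
  module ComponentAvoiding (X : VSet G) (s : Vertex G) = Reach (link? X) s

  component : VSet G → Vertex G → VSet G
  component X s = ComponentAvoiding.reachable X s

  component-avoids : ∀ X s → X s ≡ false → ∀ v → component X s v ≡ true → X v ≡ false
  component-avoids X s Xs = ComponentAvoiding.reachable-ind X s (λ v → X v ≡ false) Xs λ where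
    _ (_ , _ , Xhd , inj₁ (_ , refl)) → Xhd
    _ (_ , Xtl , _ , inj₂ (_ , refl)) → Xtl

  component-edge : ∀ X s e → X (tl e) ≡ false → X (hd e) ≡ false →
                   component X s (tl e) ≡ component X s (hd e)
  component-edge X s e Xtl Xhd = ⇔→≡ {z = true} (mk⇔
    (λ c → ComponentAvoiding.reachable-closed X s c (e , Xtl , Xhd , inj₁ (refl , refl)))
    (λ c → ComponentAvoiding.reachable-closed X s c (e , Xtl , Xhd , inj₂ (refl , refl))))

  component-const : ∀ X s (T : VSet G) →
                    (∀ e → X (tl e) ≡ false → X (hd e) ≡ false → T (tl e) ≡ T (hd e)) →
                    ∀ v → component X s v ≡ true → T v ≡ T s
  component-const X s T const = ComponentAvoiding.reachable-ind X s (λ v → T v ≡ T s) refl λ where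
    Tu (e , Xtl , Xhd , inj₁ (refl , refl)) → trans (sym (const e Xtl Xhd)) Tu
    Tu (e , Xtl , Xhd , inj₂ (refl , refl)) → trans (const e Xtl Xhd) Tu

  reaches : Vertex G → VSet G
  reaches t = ReachesTo.reachable t

  reaches-back : ∀ t e → reaches t (hd e) ≡ true → reaches t (tl e) ≡ true
  reaches-back t e r = ReachesTo.reachable-closed t r (e , refl , refl)

  reaches⇒simplePath : ∀ t v → reaches t v ≡ true → SimplePath G ρ v t
  reaches⇒simplePath t = ReachesTo.reachable-ind t (λ v → SimplePath G ρ v t) trivial
    λ p (e , e-to , e-from) → subst (λ v → SimplePath G ρ v t) e-from (prepend G ρ e e-to p)
    where
    trivial : SimplePath G ρ t t
    trivial = record { edges = [] ; walk = refl ; unique = [] ; end-fresh = λ () }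

  -- R: the vertices reaching tail e; A: the component of head e in G − R; B: the component
  -- of tail e in G − A.  Every edge leaving B goes from B ∩ R to A, so [B, V∖B] is a
  -- directed bond, and it contains e.
  module BondThrough (e : Edge G) (head-unreached : reaches (tl e) (hd e) ≡ false) where
    R A B : VSet G
    R = reaches (tl e)
    A = component R (hd e)
    B = component A (tl e)

    A∩R=∅ : ∀ v → A v ≡ true → R v ≡ false
    A∩R=∅ = component-avoids R (hd e) head-unreached

    A-tail : A (tl e) ≡ false
    A-tail = ¬-not λ At → false≢true (trans (sym (A∩R=∅ _ At)) (ReachesTo.source-reachable (tl e)))

    B∩A=∅ : ∀ v → B v ≡ true → A v ≡ false
    B∩A=∅ = component-avoids A (tl e) A-tail

    B-head : B (hd e) ≡ false
    B-head = ¬-not λ Bh → false≢true (trans (sym (B∩A=∅ _ Bh)) (ComponentAvoiding.source-reachable R (hd e)))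

    leaving : ∀ e' → Cut G B e' → B (tl e') ≡ true × A (hd e') ≡ true × R (tl e') ≡ true
    leaving e' cut with B (tl e') in Btl | B (hd e') in Bhd
    ... | true  | true  = ⊥-elim (cut⇒tail≢head G ρ B e' cut (trans Btl (sym Bhd)))
    ... | false | false = ⊥-elim (cut⇒tail≢head G ρ B e' cut (trans Btl (sym Bhd)))
    ... | true  | false = refl , Ahd , Rtl
      where
      Ahd : A (hd e') ≡ true
      Ahd = ¬-not λ Ahd → true≢false
        (trans (sym Btl) (trans (component-edge A (tl e) e' (B∩A=∅ _ Btl) Ahd) Bhd))
      Rtl : R (tl e') ≡ true
      Rtl = ¬-not λ Rtl → false≢true
        (trans (sym (B∩A=∅ _ Btl)) (trans (component-edge R (hd e) e' Rtl (A∩R=∅ _ Ahd)) Ahd))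
    ... | false | true  = ⊥-elim (false≢true (trans (sym (A∩R=∅ _ Atl)) (reaches-back (tl e) e' Rhd)))
      where
      Atl : A (tl e') ≡ true
      Atl = ¬-not λ Atl → false≢true
        (trans (sym Btl) (trans (component-edge A (tl e) e' Atl (B∩A=∅ _ Bhd)) Bhd))
      Rhd : R (hd e') ≡ true
      Rhd = ¬-not λ Rhd → true≢false
        (trans (sym Atl) (trans (component-edge R (hd e) e' (A∩R=∅ _ Atl) Rhd) (B∩A=∅ _ Bhd)))

    e∈cut : Cut G B e
    e∈cut = tail≢head⇒cut G ρ B e λ eq →
      true≢false (trans (sym (ComponentAvoiding.source-reachable A (tl e))) (trans eq B-head))

    minimal : ∀ T → (∀ e' → Cut G T e' → Cut G B e') → ∃[ e' ] Cut G T e' →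
              ∀ e' → Cut G B e' → Cut G T e'
    minimal T T⊆B (e₀ , e₀∈T) e' e'∈B = tail≢head⇒cut G ρ T e' λ eq →
      T-tail≢T-head (trans (sym (proj₁ (ends-of e' e'∈B))) (trans eq (proj₂ (ends-of e' e'∈B))))
      where
      T-on-A : ∀ v → A v ≡ true → T v ≡ T (hd e)
      T-on-A = component-const R (hd e) T λ e' Rtl _ → ¬cut⇒tail≡head G ρ T e' λ c →
        false≢true (trans (sym Rtl) (proj₂ (proj₂ (leaving e' (T⊆B e' c)))))
      T-on-B : ∀ v → B v ≡ true → T v ≡ T (tl e)
      T-on-B = component-const A (tl e) T λ e' _ Ahd → ¬cut⇒tail≡head G ρ T e' λ c →
        false≢true (trans (sym Ahd) (proj₁ (proj₂ (leaving e' (T⊆B e' c)))))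
      ends-of : ∀ e' → Cut G B e' → T (tl e') ≡ T (tl e) × T (hd e') ≡ T (hd e)
      ends-of e' c = T-on-B _ (proj₁ (leaving e' c)) , T-on-A _ (proj₁ (proj₂ (leaving e' c)))
      T-tail≢T-head : T (tl e) ≢ T (hd e)
      T-tail≢T-head eq with ends-of e₀ (T⊆B e₀ e₀∈T)
      ... | tail-T , head-T = cut⇒tail≢head G ρ T e₀ e₀∈T (trans tail-T (trans eq (sym head-T)))

    e∈EB : EB G ρ e
    e∈EB = B , (((e , e∈cut) , minimal) , inj₁ (λ e' c → proj₁ (leaving e' c))) , e∈cut

  minty : ∀ e → EC G ρ e ⊎ EB G ρ e
  minty e with reaches (tl e) (hd e) in reached
  ... | true  = inj₁ (closingPath⇒EC G ρ e (reaches⇒simplePath (tl e) (hd e) reached))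
  ... | false = inj₂ (BondThrough.e∈EB e reached)

module _ (G : Graph) where
  open Graph G
  open Minty G using (minty)

  positiveCirculation⇒¬EB : ∀ {ρ f e} → IsCirculation G ρ f → (∀ e → 0ℤ ≤ f e) → 0ℤ < f e →
                            ¬ EB G ρ e
  positiveCirculation⇒¬EB circ f≥0 0<fe (S , (_ , directed) , cut) =
    circulation-avoids-directedCut G circ f≥0 0<fe S directed cut

  positiveCirculation⇒EC : ∀ {ρ f e} → IsCirculation G ρ f → (∀ e → 0ℤ ≤ f e) → 0ℤ < f e →
                           EC G ρ e
  positiveCirculation⇒EC {ρ} {e = e} circ f≥0 0<fe with minty ρ e
  ... | inj₁ e∈EC = e∈EC
  ... | inj₂ e∈EB = ⊥-elim (positiveCirculation⇒¬EB circ f≥0 0<fe e∈EB)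

  EC⇒¬EB : ∀ {ρ e} → EC G ρ e → ¬ EB G ρ e
  EC⇒¬EB {ρ} (C , i , refl) = positiveCirculation⇒¬EB
    (closedWalk⇒circulation G ρ edge step close) (traversals≥0 G edge) (traversals>0 G edge i)
    where open DirCircuit C

  EC-reversal : ∀ ρ σ X →
    (∀ v → count G X (tail G ρ) v ≡ count G X (head G ρ) v) →
    (∀ e → X e ≡ true → Differ G ρ σ e) →
    (∀ e → EC G ρ e → Differ G ρ σ e → X e ≡ true) →
    ∀ e → EC G ρ e → EC G σ e
  EC-reversal ρ σ X eulerian X⊆Δ Δ∩EC⊆X e (C , i , refl) =
    positiveCirculation⇒EC (reorient-circulation G ρ σ h-circ) (λ d → proj₁ (sign d))
      (proj₂ (sign (edge i)) (traversals>0 G edge i))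
    where
    open DirCircuit C
    Y : Edge G → ℤ
    Y = traversals G edge
    Y≥0 : ∀ d → 0ℤ ≤ Y d
    Y≥0 = traversals≥0 G edge
    Y-circ : IsCirculation G ρ Y
    Y-circ = closedWalk⇒circulation G ρ edge step close
    M : ℤ
    M = 1ℤ + sum Y
    h : Edge G → ℤ
    h d = Y d - M * 𝟙 (X d)
    h-circ : IsCirculation G ρ h
    h-circ = circulation-combine G ρ {Y} {λ d → 𝟙 (X d)} Y-circ (eulerian⇒circulation G ρ X eulerian) M
    minus-0 : ∀ y m → y - m * 0ℤ ≡ y
    minus-0 = solve-∀
    neg-minus-0 : ∀ y m → - (y - m * 0ℤ) ≡ - y
    neg-minus-0 = solve-∀
    neg-minus-M : ∀ y s → - (y - (1ℤ + s) * 1ℤ) ≡ 1ℤ + (s - y)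
    neg-minus-M = solve-∀
    sign : ∀ d → 0ℤ ≤ reorient G ρ σ h d × (0ℤ < Y d → 0ℤ < reorient G ρ σ h d)
    sign d with ρ d ≟ᵇ σ d | X d in Xd
    ... | yes same | true  = ⊥-elim (X⊆Δ d Xd same)
    ... | yes _    | false = subst (0ℤ ≤_) (sym (minus-0 (Y d) M)) (Y≥0 d)
                           , subst (0ℤ <_) (sym (minus-0 (Y d) M))
    ... | no _     | true  = ℤ.<⇒≤ positive , λ _ → positive
      where
      positive : 0ℤ < - (Y d - M * 1ℤ)
      positive = subst (0ℤ <_) (sym (neg-minus-M (Y d) (sum Y)))
                   (ℤ.+-mono-<-≤ (+<+ (s≤s z≤n)) (ℤ.i≤j⇒0≤j-i (term≤∑ Y Y≥0 d)))
    ... | no diff  | false = ℤ.≤-reflexive (sym (trans (neg-minus-0 (Y d) M) (cong -_ Y-zero)))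
                           , λ 0<Yd → ⊥-elim (off-circuits 0<Yd)
      where
      off-circuits : ¬ (0ℤ < Y d)
      off-circuits 0<Yd =
        false≢true (trans (sym Xd) (Δ∩EC⊆X d (positiveCirculation⇒EC Y-circ Y≥0 0<Yd) diff))
      Y-zero : Y d ≡ 0ℤ
      Y-zero = ℤ.≤-antisym (ℤ.≮⇒≥ off-circuits) (Y≥0 d)

  locDirCut⊆EB : ∀ {ρ F} → IsLocDirCut G ρ F → ∀ e → F e → EB G ρ e
  locDirCut⊆EB (_ , _ , dirBonds , _ , F≐bonds) e Fe =
    Any.lookup bonds∋e , All.lookupAny dirBonds bonds∋e
    where bonds∋e = Equivalence.to (F≐bonds e) Fe

  dirEulerian⊆EC : ∀ {ρ F} → IsDirEulerian G ρ F → ∀ e → F e → EC G ρ e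
  dirEulerian⊆EC {ρ} (X , F≐X , balanced) e Fe =
    positiveCirculation⇒EC (eulerian⇒circulation G ρ X balanced) (λ d → 0≤𝟙 (X d))
      (subst (λ b → 0ℤ < 𝟙 b) (sym (Equivalence.to (F≐X e) Fe)) (+<+ (s≤s z≤n)))

  split-by-EB-EC : ∀ {ρ} {Δ D U : EdgePred G} → _≐_ G Δ (λ e → D e ⊎ U e) →
                   (∀ e → D e → EB G ρ e) → (∀ e → U e → EC G ρ e) →
                   _≐_ G D (λ e → EB G ρ e × Δ e) × _≐_ G U (λ e → EC G ρ e × Δ e)
  split-by-EB-EC {ρ} {Δ} {D} {U} Δ≐D∪U D⊆EB U⊆EC =
    (λ e → mk⇔ (λ De → D⊆EB e De , from (Δ≐D∪U e) (inj₁ De))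
                (λ (EBe , Δe) → D-side e EBe (to (Δ≐D∪U e) Δe))) ,
    (λ e → mk⇔ (λ Ue → U⊆EC e Ue , from (Δ≐D∪U e) (inj₂ Ue))
                (λ (ECe , Δe) → U-side e ECe (to (Δ≐D∪U e) Δe)))
    where
    open Equivalence
    D-side : ∀ e → EB G ρ e → D e ⊎ U e → D e
    D-side e _   (inj₁ De) = De
    D-side e EBe (inj₂ Ue) = ⊥-elim (EC⇒¬EB (U⊆EC e Ue) EBe)
    U-side : ∀ e → EC G ρ e → D e ⊎ U e → U e
    U-side e ECe (inj₁ De) = ⊥-elim (EC⇒¬EB ECe (D⊆EB e De))
    U-side e _   (inj₂ Ue) = Ue

  cutEulerian⇒parts : ∀ {ρ σ} → CutEulerianEquiv G ρ σ →
                      IsLocDirCut G ρ (λ e → EB G ρ e × Differ G ρ σ e)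
                    × IsDirEulerian G ρ (λ e → EC G ρ e × Differ G ρ σ e)
  cutEulerian⇒parts (D , U , _ , Δ≐D∪U , D-cut , U-eulerian) =
    IsLocDirCut-resp-≐ G (proj₁ split) D-cut , IsDirEulerian-resp-≐ G (proj₂ split) U-eulerian
    where split = split-by-EB-EC Δ≐D∪U (locDirCut⊆EB D-cut) (dirEulerian⊆EC U-eulerian)

  cutEulerian⇒EC⊆ : ∀ {ρ σ} → CutEulerianEquiv G ρ σ → ∀ e → EC G ρ e → EC G σ e
  cutEulerian⇒EC⊆ {ρ} {σ} (D , U , _ , Δ≐D∪U , D-cut , (X , U≐X , balanced)) =
    EC-reversal ρ σ X balanced X⊆Δ Δ∩EC⊆X
    where
    open Equivalence
    X⊆Δ : ∀ e → X e ≡ true → Differ G ρ σ e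
    X⊆Δ e Xe = from (Δ≐D∪U e) (inj₂ (from (U≐X e) Xe))
    Δ∩EC⊆X : ∀ e → EC G ρ e → Differ G ρ σ e → X e ≡ true
    Δ∩EC⊆X e ECe Δe = to (U≐X e) (from (proj₂ split e) (ECe , Δe))
      where split = split-by-EB-EC Δ≐D∪U (locDirCut⊆EB D-cut) (dirEulerian⊆EC (X , U≐X , balanced))

  cutEulerian⇒EB⊆ : ∀ {ρ σ} → CutEulerianEquiv G ρ σ → ∀ e → EB G ρ e → EB G σ e
  cutEulerian⇒EB⊆ {σ = σ} equiv e EBe with minty σ e
  ... | inj₂ EBσe = EBσe
  ... | inj₁ ECσe = ⊥-elim (EC⇒¬EB (cutEulerian⇒EC⊆ (CutEulerianEquiv-sym G equiv) e ECσe) EBe)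

  cutEulerian⇒conditions : ∀ {ρ σ} → CutEulerianEquiv G ρ σ →
      (_≐_ G (EB G ρ) (EB G σ) × _≐_ G (EC G ρ) (EC G σ))
    × IsLocDirCut G ρ (λ e → EB G ρ e × Differ G ρ σ e)
    × IsDirEulerian G ρ (λ e → EC G ρ e × Differ G ρ σ e)
  cutEulerian⇒conditions equiv =
    ( (λ e → mk⇔ (cutEulerian⇒EB⊆ equiv e) (cutEulerian⇒EB⊆ equiv′ e))
    , (λ e → mk⇔ (cutEulerian⇒EC⊆ equiv e) (cutEulerian⇒EC⊆ equiv′ e)) )
    , cutEulerian⇒parts equiv
    where equiv′ = CutEulerianEquiv-sym G equiv

  conditions⇒cutEulerian : ∀ {ρ σ} →
      (_≐_ G (EB G ρ) (EB G σ) × _≐_ G (EC G ρ) (EC G σ))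
    × IsLocDirCut G ρ (λ e → EB G ρ e × Differ G ρ σ e)
    × IsDirEulerian G ρ (λ e → EC G ρ e × Differ G ρ σ e)
    → CutEulerianEquiv G ρ σ
  conditions⇒cutEulerian {ρ} {σ} (_ , ((S , F≐cut) , bonds) , (X , U≐X , balanced)) =
    D , X , disjoint , Δ≐D∪X ,
    IsLocDirCut-resp-≐ G F≐D ((S , F≐cut) , bonds) , (X , (λ _ → ⇔.refl) , balanced)
    where
    open Equivalence
    D : Edge G → Bool
    D e = S (proj₁ (ends e)) xor S (proj₂ (ends e))
    F≐D : ∀ e → (EB G ρ e × Differ G ρ σ e) ⇔ (D e ≡ true)
    F≐D e = ⇔.trans (F≐cut e) (⇔.sym (xor≡true⇔≢ _ _))
    disjoint : ∀ e → D e ≡ true → X e ≡ true → ⊥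
    disjoint e De Xe = EC⇒¬EB (proj₁ (from (U≐X e) Xe)) (proj₁ (from (F≐D e) De))
    split : ∀ e → EC G ρ e ⊎ EB G ρ e → Differ G ρ σ e → (D e ≡ true) ⊎ (X e ≡ true)
    split e (inj₁ ECe) Δe = inj₂ (to (U≐X e) (ECe , Δe))
    split e (inj₂ EBe) Δe = inj₁ (to (F≐D e) (EBe , Δe))
    Δ≐D∪X : _≐_ G (Differ G ρ σ) (λ e → (D e ≡ true) ⊎ (X e ≡ true))
    Δ≐D∪X e = mk⇔ (split e (minty ρ e)) λ where
      (inj₁ De) → proj₂ (from (F≐D e) De)
      (inj₂ Xe) → proj₂ (from (U≐X e) Xe)

lemma4p1 : (G : Graph) (ρ σ : Orientation G) →
    CutEulerianEquiv G ρ σ ⇔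
    ( (_≐_ G (EB G ρ) (EB G σ) × _≐_ G (EC G ρ) (EC G σ))
    × IsLocDirCut G ρ (λ e → EB G ρ e × Differ G ρ σ e)
    × IsDirEulerian G ρ (λ e → EC G ρ e × Differ G ρ σ e))
lemma4p1 G ρ σ = mk⇔ (cutEulerian⇒conditions G) (conditions⇒cutEulerian G)
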